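{- Let $H$ be an $(\alpha,\beta)$-colorable hypergraph, let $q\geq \alpha+\beta+1$ and let $\chi$ be a proper $[q]$-coloring of $H$. Then there exists a good greedy coloring $\tau$ of $H$ such that there is a path in $\Gamma_q(H)$ from $\chi$ to $\tau$.
   Context: For a hypergraph $H=(V,E)$: the degree of a vertex is the number of edges containing it; a $\beta$-core is a maximal subhypergraph in which every vertex has degree at least $\beta$; for $U\subseteq V$, "$U$ has a $\beta$-core" means the subhypergraph induced by $U$ has a nonempty $\beta$-core. A set is independent if it contains no edge. A sequence $V_1,\dots,V_\alpha$ of (possibly empty) sets is a maximally independent sequence of length $\alpha$ if for each $j$, $V_j$ is a maximal independent set in the subhypergraph induced by $V\setminus\bigcup_{i<j}V_i$. $H$ is $(\alpha,\beta)$-colorable if there is no maximally independent sequence of length $\alpha$ such that $V\setminus\bigcup_{i\leq\alpha}V_i$ has a $\beta$-core. A proper $[q]$-coloring is a map $V\to[q]$ with no monochromatic edge; $\Gamma_q(H)$ is the graph on proper $[q]$-colorings with adjacency meaning differing on exactly one vertex. A good greedy coloring is a proper coloring with color classes $V_1,V_2,\dots,V_{\alpha+\beta}$ (where $V_i$ is the class of color $i$) such that (i) $V_1,\dots,V_\alpha$ is a maximally independent sequence of length $\alpha$ and (ii) $V\setminus\bigcup_{\ell\leq\alpha}V_\ell$ has no $\beta$-core. -}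

module Defs where

open import Data.Nat using (ℕ; _≤_; _+_; suc)
open import Data.Fin using (Fin; toℕ)
open import Data.Fin.Subset using (Subset; _∈_; _∉_; _⊆_; _∪_; _─_; ⁅_⁆; ⊤; Nonempty)
open import Data.Fin.Subset.Properties using (_∈?_; _⊆?_)
open import Data.Fin.Properties using () renaming (_≟_ to _≟ᶠ_)
import Data.Nat.Properties as ℕP
open import Data.List using (List; []; _∷_; length; filter)
open import Data.List.Membership.Propositional using () renaming (_∈_ to _∈ˡ_)
open import Data.List.Relation.Unary.Unique.Propositional using (Unique)
open import Data.Vec using (tabulate)
open import Data.Product using (Σ; ∃; _×_; _,_)
open import Relation.Nullary using (¬_; does; _×-dec_)
open import Relation.Binary.PropositionalEquality using (_≡_; _≢_)
open import Relation.Binary.Construct.Closure.ReflexiveTransitive using (Star)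

-- A finite hypergraph on the vertex set Fin n; edges are subsets of Fin n,
-- listed without repetition (so the edge *set* is well defined).
record Hypergraph : Set where
  field
    n      : ℕ
    edges  : List (Subset n)
    simple : Unique edges
open Hypergraph public

module _ (H : Hypergraph) where

  V : Set
  V = Fin (n H)

  VSet : Set
  VSet = Subset (n H)

  degreeIn : VSet → V → ℕ
  degreeIn U v = length (filter (λ e → (v ∈? e) ×-dec (e ⊆? U)) (edges H))

  -- "U has a β-core": the β-core of H[U] is nonempty, i.e. there is a nonempty
  -- C ⊆ U such that every vertex of C has degree ≥ β in H[C]
  -- (the β-core is the union of all such C).
  HasCore : ℕ → VSet → Set
  HasCore β U = Σ VSet λ C → C ⊆ U × Nonempty C × (∀ v → v ∈ C → β ≤ degreeIn C v)

  Independent : VSet → Set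
  Independent I = ∀ e → e ∈ˡ edges H → ¬ (e ⊆ I)

  MaxIndIn : VSet → VSet → Set
  MaxIndIn W I = I ⊆ W × Independent I ×
                 (∀ v → v ∈ W → v ∉ I → ¬ Independent (I ∪ ⁅ v ⁆))

  -- MaxIndSeqFrom W Vs : Vs = V₁,…,V_k with each Vⱼ maximal independent in
  -- H[W ∖ ⋃_{i<j} Vᵢ]
  data MaxIndSeqFrom : VSet → List VSet → Set where
    []  : ∀ {W} → MaxIndSeqFrom W []
    _∷_ : ∀ {W I Is} → MaxIndIn W I → MaxIndSeqFrom (W ─ I) Is →
          MaxIndSeqFrom W (I ∷ Is)

  remove : VSet → List VSet → VSet
  remove W []       = W
  remove W (I ∷ Is) = remove (W ─ I) Is

  MaxIndSeq : ℕ → List VSet → Set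
  MaxIndSeq α Is = length Is ≡ α × MaxIndSeqFrom ⊤ Is

  ColorableAB : ℕ → ℕ → Set
  ColorableAB α β = ∀ Is → MaxIndSeq α Is → ¬ HasCore β (remove ⊤ Is)

  -- colorings with colors Fin q = {0,…,q-1} (colour i+1 of the paper is i here)
  Coloring : ℕ → Set
  Coloring q = V → Fin q

  Monochromatic : ∀ {q} → Coloring q → VSet → Set
  Monochromatic χ e = ∀ u w → u ∈ e → w ∈ e → χ u ≡ χ w

  Proper : ∀ {q} → Coloring q → Set
  Proper χ = ∀ e → e ∈ˡ edges H → ¬ Monochromatic χ e

  GammaEdge : (q : ℕ) → Coloring q → Coloring q → Set
  GammaEdge q χ τ = Proper χ × Proper τ ×
    (Σ V λ v → χ v ≢ τ v × (∀ w → w ≢ v → χ w ≡ τ w))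

  GammaPath : (q : ℕ) → Coloring q → Coloring q → Set
  GammaPath q = Star (GammaEdge q)

  colorClass : ∀ {q} → Coloring q → ℕ → VSet
  colorClass τ i = tabulate (λ v → does (toℕ (τ v) ℕP.≟ i))

  classesFrom : ∀ {q} → Coloring q → ℕ → ℕ → List VSet
  classesFrom τ s 0       = []
  classesFrom τ s (suc k) = colorClass τ s ∷ classesFrom τ (suc s) k

  GoodGreedy : (q α β : ℕ) → Coloring q → Set
  GoodGreedy q α β τ =
    Proper τ ×
    (∀ v → suc (toℕ (τ v)) ≤ α + β) ×       -- only colours 1..α+β are used
    MaxIndSeq α (classesFrom τ 0 α) ×
    ¬ HasCore β (remove ⊤ (classesFrom τ 0 α))

-- First, for j = 0, …, α − 1 in turn, one sweep over all vertices gives color j to every vertex of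
-- larger color that no edge prevents from taking it. Later sweeps never touch colors ≤ j, so the
-- classes 0, …, α − 1 end up a maximally independent sequence and, by (α, β)-colorability, the set
-- R of remaining vertices has no β-core. Vertices outside R keep colors below α, below every new color, so edges meeting them
-- never become monochromatic.

module Submission where

open import Defs
open import Data.Bool using (true)
open import Data.Empty using (⊥-elim)
open import Data.Fin using (Fin; zero; suc; toℕ; fromℕ<)
open import Data.Fin.Properties using (any?; all?; toℕ-fromℕ<; toℕ-injective) renaming (_≟_ to _≟ᶠ_)
open import Data.Fin.Subset using (Subset; _∈_; _∉_; _⊆_; _─_; _-_; _∪_; ⁅_⁆; ⊤; Nonempty; ∣_∣)
open import Data.Fin.Subset.Properties
  using (_∈?_; _⊆?_; nonempty?; ∈⊤; x∈⁅x⁆; x∈p∧x∉q⇒x∈p─q; x∈p∧x≢y⇒x∈p-y; p─q⊆p; x∈p∪q⁺; x∈p⇒∣p-x∣<∣p∣)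
open import Data.List using (List; []; _∷_; [_]; length; filter; map; _++_; allFin)
open import Data.List.Membership.Propositional using (find; lose) renaming (_∈_ to _∈ˡ_; _∉_ to _∉ˡ_)
open import Data.List.Membership.Propositional.Properties using (∈-filter⁺; ∈-map⁺; ∈-++⁺ˡ; ∈-++⁺ʳ; ∈-allFin)
open import Data.List.Properties using (filter-notAll; length-map; length-++)
open import Data.List.Relation.Unary.Any as Any using (Any; here; there)
open import Data.Nat using (ℕ; zero; suc; _≤_; _<_; _+_; z≤n; s≤s; z<s; _<?_)
open import Data.Nat.Properties
open import Data.List.Membership.DecPropositional _≟_ using () renaming (_∈?_ to _∈ˡ?_)
open import Data.Product using (Σ; ∃; _×_; _,_; proj₁; proj₂)
open import Data.Sum using (_⊎_; inj₁; inj₂)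
open import Data.Vec using (_∷_)
import Data.Vec.Base as Vec
open import Data.Vec.Properties using ([]=⇒lookup; lookup⇒[]=; lookup∘tabulate)
open import Data.Vec.Functional using (updateAt)
open import Data.Vec.Functional.Properties using (updateAt-updates; updateAt-minimal)
open import Function using (id; const; _∘_; _⇔_; mk⇔; Equivalence)
open Equivalence using (to; from)
open import Relation.Binary.Construct.Closure.ReflexiveTransitive as Star using (Star; ε; _◅_; _◅◅_)
open import Relation.Binary.PropositionalEquality using (_≡_; _≢_; refl; sym; trans; cong; subst)
open import Relation.Nullary.Decidable using (dec-true)
open import Relation.Nullary using (¬_; does; Dec; yes; no; ¬?; _×-dec_; _→-dec_)

does⇒ : ∀ {A : Set} (a? : Dec A) → does a? ≡ true → A
does⇒ (yes a) _ = a
does⇒ (no _)  ()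

x∈p─q⇒x∉q : ∀ {n} {p q : Subset n} {x} → x ∈ p ─ q → x ∉ q
x∈p─q⇒x∉q {p = _ ∷ _} {true ∷ _} {zero}  ()             Vec.here
x∈p─q⇒x∉q {p = _ ∷ _} {_ ∷ _}    {suc _} (Vec.there x∈) (Vec.there x∈q) = x∈p─q⇒x∉q x∈ x∈q

⊆-or-∃∉ : ∀ {n} (p q : Subset n) → p ⊆ q ⊎ ∃ λ x → x ∈ p × x ∉ q
⊆-or-∃∉ p q with any? (λ x → (x ∈? p) ×-dec (¬? (x ∈? q)))
... | yes found = inj₂ found
... | no none   = inj₁ λ {x} x∈p → decide x x∈p (x ∈? q)
  where
  decide : ∀ x → x ∈ p → Dec (x ∈ q) → x ∈ q
  decide x _   (yes x∈q) = x∈q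
  decide x x∈p (no x∉q)  = ⊥-elim (none (x , x∈p , x∉q))

fresh-within : ∀ k a (F : List ℕ) → length F ≤ k → ∃ λ x → a ≤ x × x ≤ a + k × x ∉ˡ F
fresh-within zero    a []  _       = a , ≤-refl , m≤m+n a 0 , λ ()
fresh-within (suc k) a F   |F|≤1+k with a ∈ˡ? F
... | no a∉F = a , ≤-refl , m≤m+n a (suc k) , a∉F
... | yes a∈F with fresh-within k (suc a) (filter (¬? ∘ (_≟ a)) F) shorter
  where
  shorter : length (filter (¬? ∘ (_≟ a)) F) ≤ k
  shorter = ≤-pred (≤-trans (filter-notAll (¬? ∘ (_≟ a)) F (Any.map (λ a≡x x≢a → x≢a (sym a≡x)) a∈F)) |F|≤1+k)
... | x , a<x , x≤1+a+k , x∉F′ = x , <⇒≤ a<x , subst (x ≤_) (sym (+-suc a k)) x≤1+a+k ,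
  λ x∈F → x∉F′ (∈-filter⁺ (¬? ∘ (_≟ a)) x∈F (<⇒≢ a<x ∘ sym))

fresh-between : ∀ a (F : List ℕ) → ∃ λ x → a ≤ x × x ≤ a + length F × x ∉ˡ F
fresh-between a F = fresh-within (length F) a F ≤-refl

module _ (H : Hypergraph) where

  NontrivialEdges : Set
  NontrivialEdges = ∀ {e} → e ∈ˡ edges H → ∀ v → ∃ λ w → w ∈ e × w ≢ v

  proper⇒nontrivialEdges : ∀ {q} {χ : Coloring H q} → Proper H χ → NontrivialEdges
  proper⇒nontrivialEdges {χ = χ} χ-proper {e} e∈ v with any? (λ w → (w ∈? e) ×-dec (¬? (w ≟ᶠ v)))
  ... | yes found = found
  ... | no none   = ⊥-elim (χ-proper e e∈ λ x y x∈ y∈ → cong χ (trans (only-v x∈) (sym (only-v y∈))))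
    where
    only-v : ∀ {x} → x ∈ e → x ≡ v
    only-v {x} x∈ with x ≟ᶠ v
    ... | yes x≡v = x≡v
    ... | no x≢v  = ⊥-elim (none (x , x∈ , x≢v))

  ¬core-⊆ : ∀ {β A B} → A ⊆ B → ¬ HasCore H β B → ¬ HasCore H β A
  ¬core-⊆ A⊆B no-core (C , C⊆A , nonempty , deg) = no-core (C , A⊆B ∘ C⊆A , nonempty , deg)

  low-degree-vertex : ∀ {β} S → ¬ HasCore H β S → Nonempty S → ∃ λ v → v ∈ S × degreeIn H S v < β
  low-degree-vertex {β} S no-core nonempty with any? (λ v → (v ∈? S) ×-dec (degreeIn H S v <? β))
  ... | yes found = found
  ... | no none   = ⊥-elim (no-core (S , id , nonempty , λ v v∈ → ≮⇒≥ λ deg<β → none (v , v∈ , deg<β)))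

module Colorings (H : Hypergraph) (q : ℕ) where

  Col : Set
  Col = Coloring H q

  _[_≔_] : Col → V H → Fin q → Col
  χ [ v ≔ c ] = updateAt χ v (const c)

  ≔-updates : ∀ χ v c → (χ [ v ≔ c ]) v ≡ c
  ≔-updates χ v c = updateAt-updates v χ

  ≔-minimal : ∀ χ v c {w} → w ≢ v → (χ [ v ≔ c ]) w ≡ χ w
  ≔-minimal χ v c {w} = updateAt-minimal w v χ

  AgreeOff : V H → Col → Col → Set
  AgreeOff v χ τ = ∀ w → w ≢ v → χ w ≡ τ w

  ≔-agreeOff : ∀ {v φ χ} c → AgreeOff v φ χ → AgreeOff v (φ [ v ≔ c ]) χ
  ≔-agreeOff {v} {φ} c φ≈χ w w≢v = trans (≔-minimal φ v c w≢v) (φ≈χ w w≢v)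

  monochromatic-resp : ∀ {φ ψ : Col} {e} → (∀ x → x ∈ e → φ x ≡ ψ x) →
                       Monochromatic H φ e → Monochromatic H ψ e
  monochromatic-resp φ≡ψ mono u w u∈ w∈ = trans (sym (φ≡ψ u u∈)) (trans (mono u w u∈ w∈) (φ≡ψ w w∈))

  ≔-changes : ∀ {χ v c} → χ v ≢ c → χ v ≢ (χ [ v ≔ c ]) v
  ≔-changes {χ} {v} {c} χv≢c eq = χv≢c (trans eq (≔-updates χ v c))

  agreeOff-≔ : ∀ χ v c → AgreeOff v χ (χ [ v ≔ c ])
  agreeOff-≔ χ v c _ w≢v = sym (≔-minimal χ v c w≢v)

  ∈-colorClass⁻ : ∀ (τ : Col) i {x} → x ∈ colorClass H τ i → toℕ (τ x) ≡ i
  ∈-colorClass⁻ τ i {x} x∈ =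
    does⇒ (toℕ (τ x) ≟ i) (trans (sym (lookup∘tabulate (λ v → does (toℕ (τ v) ≟ i)) x)) ([]=⇒lookup x∈))

  ∈-colorClass⁺ : ∀ (τ : Col) i {x} → toℕ (τ x) ≡ i → x ∈ colorClass H τ i
  ∈-colorClass⁺ τ i {x} τx≡i =
    lookup⇒[]= x _ (trans (lookup∘tabulate (λ v → does (toℕ (τ v) ≟ i)) x) (dec-true (toℕ (τ x) ≟ i) τx≡i))

  FixesBelow : ℕ → Col → Col → Set
  FixesBelow j τ τ′ = ∀ x → toℕ (τ x) < j → τ′ x ≡ τ x

  fixesBelow-refl : ∀ {j} τ → FixesBelow j τ τ
  fixesBelow-refl τ _ _ = refl

  fixesBelow-trans : ∀ {j τ₁ τ₂ τ₃} → FixesBelow j τ₁ τ₂ → FixesBelow j τ₂ τ₃ → FixesBelow j τ₁ τ₃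
  fixesBelow-trans {j} f₁₂ f₂₃ x τ₁x<j =
    trans (f₂₃ x (subst (λ c → toℕ c < j) (sym (f₁₂ x τ₁x<j)) τ₁x<j)) (f₁₂ x τ₁x<j)

  ColoredAtLeast : ℕ → Col → VSet H → Set
  ColoredAtLeast s τ W = ∀ w → w ∈ W ⇔ s ≤ toℕ (τ w)

  coloredAtLeast-⊤ : ∀ τ → ColoredAtLeast 0 τ ⊤
  coloredAtLeast-⊤ τ w = mk⇔ (λ _ → z≤n) (λ _ → ∈⊤)

  coloredAtLeast-─ : ∀ {s τ W} → ColoredAtLeast s τ W → ColoredAtLeast (suc s) τ (W ─ colorClass H τ s)
  coloredAtLeast-─ {s} {τ} {W} W≥s w = mk⇔
    (λ w∈ → ≤∧≢⇒< (to (W≥s w) (p─q⊆p W _ w∈)) λ s≡τw → x∈p─q⇒x∉q w∈ (∈-colorClass⁺ τ s (sym s≡τw)))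
    (λ s<τw → x∈p∧x∉q⇒x∈p─q (from (W≥s w) (<⇒≤ s<τw)) λ w∈C → <⇒≢ s<τw (sym (∈-colorClass⁻ τ s w∈C)))

  coloredAtLeast-remove : ∀ {s τ W} k → ColoredAtLeast s τ W →
                          ColoredAtLeast (s + k) τ (remove H W (classesFrom H τ s k))
  coloredAtLeast-remove {s} {τ} {W} zero W≥s =
    subst (λ t → ColoredAtLeast t τ W) (sym (+-identityʳ s)) W≥s
  coloredAtLeast-remove {s} {τ} {W} (suc k) W≥s =
    subst (λ t → ColoredAtLeast t τ (remove H W (classesFrom H τ s (suc k)))) (sym (+-suc s k))
          (coloredAtLeast-remove k (coloredAtLeast-─ W≥s))

module GreedySweeps (H : Hypergraph) (q : ℕ) where

  open Colorings H q

  Blocked : Col → V H → ℕ → Set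
  Blocked τ w j = Any (λ e → ∀ x → x ∈ e → x ≢ w → toℕ (τ x) ≡ j) (edges H)

  blocked? : ∀ τ w j → Dec (Blocked τ w j)
  blocked? τ w j = Any.any? (λ e → all? λ x → (x ∈? e) →-dec (¬? (x ≟ᶠ w) →-dec (toℕ (τ x) ≟ j))) (edges H)

  ClassMaximal : ℕ → Col → Set
  ClassMaximal i τ = ∀ w → i < toℕ (τ w) → Blocked τ w i

  blocked-fixesBelow : ∀ {i j τ τ′ w} → i < j → FixesBelow j τ τ′ → Blocked τ w i → Blocked τ′ w i
  blocked-fixesBelow {j = j} i<j fixes = Any.map λ others x x∈ x≢w →
    trans (cong toℕ (fixes x (subst (_< j) (sym (others x x∈ x≢w)) i<j))) (others x x∈ x≢w)

  classMaximal-fixesBelow : ∀ {i j τ τ′} → i < j → FixesBelow j τ τ′ → ClassMaximal i τ → ClassMaximal i τ′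
  classMaximal-fixesBelow {i} {j} {τ} i<j fixes maximal w i<τ′w = blocked-fixesBelow i<j fixes (maximal w i<τw)
    where
    i<τw : i < toℕ (τ w)
    i<τw with toℕ (τ w) <? j
    ... | yes τw<j = subst (λ c → i < toℕ c) (fixes w τw<j) i<τ′w
    ... | no τw≮j  = <-≤-trans i<j (≮⇒≥ τw≮j)

  proper-≔-unblocked : ∀ {τ w} c → Proper H τ → ¬ Blocked τ w (toℕ c) → Proper H (τ [ w ≔ c ])
  proper-≔-unblocked {τ} {w} c τ-proper unblocked e e∈ mono with w ∈? e
  ... | no w∉e  = τ-proper e e∈ (monochromatic-resp (λ x x∈ → ≔-minimal τ w c λ { refl → w∉e x∈ }) mono)
  ... | yes w∈e = unblocked (lose e∈ λ x x∈ x≢w →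
    cong toℕ (trans (sym (≔-minimal τ w c x≢w)) (trans (mono x w x∈ w∈e) (≔-updates τ w c))))

  module Sweep (j : ℕ) (j<q : j < q) where

    cⱼ : Fin q
    cⱼ = fromℕ< j<q

    record Swept (τ : Col) (Done : V H → Set) : Set where
      constructor swept
      field
        τ′      : Col
        path    : GammaPath H q τ τ′
        proper  : Proper H τ′
        blocked : ∀ w → Done w → j < toℕ (τ′ w) → Blocked τ′ w j
        fixes   : FixesBelow (suc j) τ τ′

    lower : ∀ τ w → Proper H τ → Swept τ (_≡ w)
    lower τ w τ-proper with j <? toℕ (τ w) | blocked? τ w j
    ... | no j≮τw | _          = swept τ ε τ-proper (λ { _ refl j<τw → ⊥-elim (j≮τw j<τw) }) (fixesBelow-refl τ)
    ... | yes _   | yes blocked = swept τ ε τ-proper (λ { _ refl _ → blocked }) (fixesBelow-refl τ)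
    ... | yes j<τw | no unblocked = swept τ′ (move-w ◅ ε) τ′-proper done fixes
      where
      τ′ : Col
      τ′ = τ [ w ≔ cⱼ ]
      τ′w≡j : toℕ (τ′ w) ≡ j
      τ′w≡j = trans (cong toℕ (≔-updates τ w cⱼ)) (toℕ-fromℕ< j<q)
      τ′-proper : Proper H τ′
      τ′-proper = proper-≔-unblocked cⱼ τ-proper (unblocked ∘ subst (Blocked τ w) (toℕ-fromℕ< j<q))
      τw≢cⱼ : τ w ≢ cⱼ
      τw≢cⱼ τw≡cⱼ = <-irrefl (sym (trans (cong toℕ τw≡cⱼ) (toℕ-fromℕ< j<q))) j<τw
      move-w : GammaEdge H q τ τ′
      move-w = τ-proper , τ′-proper , w , ≔-changes τw≢cⱼ , agreeOff-≔ τ w cⱼ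
      done : ∀ x → x ≡ w → j < toℕ (τ′ x) → Blocked τ′ x j
      done _ refl j<τ′w = ⊥-elim (<-irrefl (sym τ′w≡j) j<τ′w)
      fixes : FixesBelow (suc j) τ τ′
      fixes x τx≤j = ≔-minimal τ w cⱼ λ { refl → <-irrefl refl (<-≤-trans j<τw (≤-pred τx≤j)) }

    sweep : ∀ ws τ → Proper H τ → Swept τ (_∈ˡ ws)
    sweep []       τ τ-proper = swept τ ε τ-proper (λ _ ()) (fixesBelow-refl τ)
    sweep (w ∷ ws) τ τ-proper with lower τ w τ-proper
    ... | swept τ₁ P₁ p₁ b₁ f₁ with sweep ws τ₁ p₁
    ... | swept τ₂ P₂ p₂ b₂ f₂ = swept τ₂ (P₁ ◅◅ P₂) p₂ done (fixesBelow-trans f₁ f₂)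
      where
      done : ∀ x → x ∈ˡ w ∷ ws → j < toℕ (τ₂ x) → Blocked τ₂ x j
      done x (there x∈ws) = b₂ x x∈ws
      done x (here refl) j<τ₂x with j <? toℕ (τ₁ x)
      ... | yes j<τ₁x = blocked-fixesBelow ≤-refl f₂ (b₁ x refl j<τ₁x)
      ... | no j≮τ₁x  = ⊥-elim (j≮τ₁x (subst (λ c → j < toℕ c) (f₂ x (s≤s (≮⇒≥ j≮τ₁x))) j<τ₂x))

  record Greedy (χ : Col) (k : ℕ) : Set where
    constructor greedy
    field
      τ       : Col
      path    : GammaPath H q χ τ
      proper  : Proper H τ
      maximal : ∀ i → i < k → ClassMaximal i τ

  greedy-sweeps : ∀ χ → Proper H χ → ∀ k → k ≤ q → Greedy χ k
  greedy-sweeps χ χ-proper zero    _   = greedy χ ε χ-proper (λ _ ())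
  greedy-sweeps χ χ-proper (suc k) k<q with greedy-sweeps χ χ-proper k (<⇒≤ k<q)
  ... | greedy τ P τ-proper maximal with Sweep.sweep k k<q (allFin _) τ τ-proper
  ... | Sweep.swept τ′ P′ τ′-proper blocked fixes = greedy τ′ (P ◅◅ P′) τ′-proper maximal′
    where
    maximal′ : ∀ i → i < suc k → ClassMaximal i τ′
    maximal′ i i<1+k with m<1+n⇒m<n∨m≡n i<1+k
    ... | inj₁ i<k  = classMaximal-fixesBelow i<1+k fixes (maximal i i<k)
    ... | inj₂ refl = λ w → blocked w (∈-allFin w)

  colorClass-maxIndIn : ∀ {s τ W} → Proper H τ → ColoredAtLeast s τ W → ClassMaximal s τ →
                        MaxIndIn H W (colorClass H τ s)
  colorClass-maxIndIn {s} {τ} {W} τ-proper W≥s maximal = C⊆W , independent , maximal′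
    where
    C : VSet H
    C = colorClass H τ s
    C⊆W : C ⊆ W
    C⊆W {x} x∈C = from (W≥s x) (≤-reflexive (sym (∈-colorClass⁻ τ s x∈C)))
    independent : Independent H C
    independent e e∈ e⊆C = τ-proper e e∈ λ u w u∈ w∈ →
      toℕ-injective (trans (∈-colorClass⁻ τ s (e⊆C u∈)) (sym (∈-colorClass⁻ τ s (e⊆C w∈))))
    maximal′ : ∀ v → v ∈ W → v ∉ C → ¬ Independent H (C ∪ ⁅ v ⁆)
    maximal′ v v∈W v∉C independent′
      with find (maximal v (≤∧≢⇒< (to (W≥s v) v∈W) λ s≡τv → v∉C (∈-colorClass⁺ τ s (sym s≡τv))))
    ... | e , e∈ , others = independent′ e e∈ e⊆
      where
      e⊆ : e ⊆ C ∪ ⁅ v ⁆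
      e⊆ {x} x∈ with x ≟ᶠ v
      ... | yes refl = x∈p∪q⁺ (inj₂ (x∈⁅x⁆ x))
      ... | no x≢v   = x∈p∪q⁺ (inj₁ (∈-colorClass⁺ τ s (others x x∈ x≢v)))

  maxIndSeqFrom-classesFrom : ∀ {τ} → Proper H τ → ∀ k {s W} → ColoredAtLeast s τ W →
    (∀ i → s ≤ i → i < s + k → ClassMaximal i τ) → MaxIndSeqFrom H W (classesFrom H τ s k)
  maxIndSeqFrom-classesFrom τ-proper zero    W≥s maximal = []
  maxIndSeqFrom-classesFrom τ-proper (suc k) {s} W≥s maximal =
    colorClass-maxIndIn τ-proper W≥s (maximal s ≤-refl (m<m+n s z<s)) ∷
    maxIndSeqFrom-classesFrom τ-proper k (coloredAtLeast-─ W≥s) λ i s<i i<1+s+k →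
      maximal i (<⇒≤ s<i) (subst (i <_) (sym (+-suc s k)) i<1+s+k)

  length-classesFrom : ∀ (τ : Col) s k → length (classesFrom H τ s k) ≡ k
  length-classesFrom τ s zero    = refl
  length-classesFrom τ s (suc k) = cong suc (length-classesFrom τ (suc s) k)

module DegenerateRecoloring (H : Hypergraph) (q α β : ℕ) (α+β<q : α + β < q) (R : VSet H)
                            (nontrivial : NontrivialEdges H) where

  open Colorings H q

  Low : Col → Set
  Low χ = ∀ w → w ∉ R → toℕ (χ w) < α

  -- Edges through a vertex of R ∖ S are unconstrained: this lets the recursion on S - v ignore v.
  ProperOn : VSet H → Col → Set
  ProperOn S χ = ∀ e → e ∈ˡ edges H → (∀ w → w ∈ e → w ∈ R → w ∈ S) → ¬ Monochromatic H χ e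

  Step : VSet H → Col → Col → Set
  Step S χ τ = ProperOn S χ × ProperOn S τ × ∃ λ u → u ∈ S × χ u ≢ τ u × AgreeOff u χ τ

  properOn-⊆ : ∀ {S S′ χ} → S′ ⊆ S → ProperOn S χ → ProperOn S′ χ
  properOn-⊆ S′⊆S χ-proper e e∈ confined = χ-proper e e∈ λ w w∈e w∈R → S′⊆S (confined w w∈e w∈R)

  low-step : ∀ {S χ τ} → S ⊆ R → Step S χ τ → Low χ → Low τ
  low-step S⊆R (_ , _ , u , u∈S , _ , χ≈τ) χ-low w w∉R =
    subst (λ c → toℕ c < α) (χ≈τ w λ { refl → w∉R (S⊆R u∈S) }) (χ-low w w∉R)

  other : V H → VSet H → V H
  other v e with any? (λ w → (w ∈? e) ×-dec (¬? (w ≟ᶠ v)))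
  ... | yes (w , _) = w
  ... | no _        = v

  other-spec : ∀ {e} → e ∈ˡ edges H → ∀ v → other v e ∈ e × other v e ≢ v
  other-spec {e} e∈ v with any? (λ w → (w ∈? e) ×-dec (¬? (w ≟ᶠ v)))
  ... | yes (_ , spec) = spec
  ... | no none        = ⊥-elim (none (nontrivial e∈ v))

  -- Recoloring v makes an edge e ⊆ S through v monochromatic only if v gets the color of other v e.
  forcedColors : Col → VSet H → V H → List ℕ
  forcedColors χ S v = map (λ e → toℕ (χ (other v e))) (filter (λ e → (v ∈? e) ×-dec (e ⊆? S)) (edges H))

  length-forcedColors : ∀ χ S v → length (forcedColors χ S v) ≡ degreeIn H S v
  length-forcedColors χ S v = length-map _ (filter (λ e → (v ∈? e) ×-dec (e ⊆? S)) (edges H))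

  other-forced : ∀ χ {S v e} → e ∈ˡ edges H → e ⊆ S → v ∈ e → toℕ (χ (other v e)) ∈ˡ forcedColors χ S v
  other-forced χ {S} {v} e∈ e⊆S v∈e = ∈-map⁺ _ (∈-filter⁺ (λ e → (v ∈? e) ×-dec (e ⊆? S)) e∈ (v∈e , e⊆S))

  monochromatic⇒≡other : ∀ {φ χ v e} → AgreeOff v φ χ → e ∈ˡ edges H → v ∈ e →
                         Monochromatic H φ e → φ v ≡ χ (other v e)
  monochromatic⇒≡other {v = v} {e} φ≈χ e∈ v∈e mono =
    trans (mono v (other v e) v∈e (proj₁ (other-spec e∈ v))) (φ≈χ _ (proj₂ (other-spec e∈ v)))

  monochromatic⇒forced : ∀ {φ χ S v e} → AgreeOff v φ χ → e ∈ˡ edges H → e ⊆ S → v ∈ e →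
                         Monochromatic H φ e → toℕ (φ v) ∈ˡ forcedColors χ S v
  monochromatic⇒forced {χ = χ} φ≈χ e∈ e⊆S v∈e mono =
    subst (_∈ˡ _) (cong toℕ (sym (monochromatic⇒≡other φ≈χ e∈ v∈e mono))) (other-forced χ e∈ e⊆S v∈e)

  monochromatic⇒forced-or-moved :
    ∀ {φ χ₁ χ₂ S u v e} → AgreeOff v φ χ₂ → AgreeOff u χ₁ χ₂ → e ∈ˡ edges H → e ⊆ S → v ∈ e →
    Monochromatic H φ e → toℕ (φ v) ∈ˡ forcedColors χ₁ S v ++ [ toℕ (χ₂ u) ]
  monochromatic⇒forced-or-moved {φ} {χ₁} {χ₂} {u = u} {v} {e} φ≈χ₂ χ₁≈χ₂ e∈ e⊆S v∈e mono
    with other v e ≟ᶠ u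
  ... | yes o≡u = ∈-++⁺ʳ _ (here (cong toℕ (trans (monochromatic⇒≡other φ≈χ₂ e∈ v∈e mono) (cong χ₂ o≡u))))
  ... | no o≢u  = ∈-++⁺ˡ (subst (_∈ˡ _) (cong toℕ (sym φv≡χ₁o)) (other-forced χ₁ e∈ e⊆S v∈e))
    where
    φv≡χ₁o : φ v ≡ χ₁ (other v e)
    φv≡χ₁o = trans (monochromatic⇒≡other φ≈χ₂ e∈ v∈e mono) (sym (χ₁≈χ₂ _ o≢u))

  properOn-≔ : ∀ {S v φ χ d} → v ∈ S → AgreeOff v φ χ → ProperOn (S - v) χ → Low χ → α ≤ toℕ d →
    (∀ e → e ∈ˡ edges H → e ⊆ S → v ∈ e → ¬ Monochromatic H (φ [ v ≔ d ]) e) → ProperOn S (φ [ v ≔ d ])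
  properOn-≔ {S} {v} {φ} {χ} {d} v∈S φ≈χ χ-proper χ-low α≤d through-v e e∈ confined mono with v ∈? e
  ... | no v∉e = χ-proper e e∈ confined′ (monochromatic-resp (λ x x∈e → ≔-agreeOff d φ≈χ x (∈e⇒≢v x∈e)) mono)
    where
    ∈e⇒≢v : ∀ {x} → x ∈ e → x ≢ v
    ∈e⇒≢v x∈e refl = v∉e x∈e
    confined′ : ∀ w → w ∈ e → w ∈ R → w ∈ S - v
    confined′ w w∈e w∈R = x∈p∧x≢y⇒x∈p-y (confined w w∈e w∈R) (∈e⇒≢v w∈e)
  ... | yes v∈e with ⊆-or-∃∉ e S
  ...   | inj₁ e⊆S = through-v e e∈ e⊆S v∈e mono
  ...   | inj₂ (w , w∈e , w∉S) = <⇒≱ (subst (λ c → toℕ c < α) χw≡d (χ-low w w∉R)) α≤d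
    where
    -- w lies outside R, so its color stays below α ≤ d.
    w≢v : w ≢ v
    w≢v refl = w∉S v∈S
    w∉R : w ∉ R
    w∉R w∈R = w∉S (confined w w∈e w∈R)
    χw≡d : χ w ≡ d
    χw≡d = trans (sym (≔-agreeOff d φ≈χ w w≢v)) (trans (mono w v w∈e v∈e) (≔-updates φ v d))

  properOn-≔-fresh : ∀ {S v φ χ d} → v ∈ S → AgreeOff v φ χ → ProperOn (S - v) χ → Low χ → α ≤ toℕ d →
                     toℕ d ∉ˡ forcedColors χ S v → ProperOn S (φ [ v ≔ d ])
  properOn-≔-fresh {v = v} {φ} {d = d} v∈S φ≈χ χ-proper χ-low α≤d d-fresh =
    properOn-≔ v∈S φ≈χ χ-proper χ-low α≤d λ e e∈ e⊆S v∈e mono →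
      d-fresh (subst (_∈ˡ _) (cong toℕ (≔-updates φ v d)) (monochromatic⇒forced (≔-agreeOff d φ≈χ) e∈ e⊆S v∈e mono))

  fresh-color : ∀ (F : List ℕ) → length F ≤ β → ∃ λ (c : Fin q) → α ≤ toℕ c × toℕ c ≤ α + length F × toℕ c ∉ˡ F
  fresh-color F |F|≤β with fresh-between α F
  ... | x , x-fresh@(_ , x≤α+|F| , _) =
    fromℕ< x<q , subst (λ y → α ≤ y × y ≤ α + length F × y ∉ˡ F) (sym (toℕ-fromℕ< x<q)) x-fresh
    where
    x<q : x < q
    x<q = ≤-<-trans (≤-trans x≤α+|F| (+-monoʳ-≤ α |F|≤β)) α+β<q

  recolor : ∀ {S v ψ} d → v ∈ S → ProperOn S ψ → ProperOn S (ψ [ v ≔ d ]) →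
            ∃ λ ψ′ → Star (Step S) ψ ψ′ × ProperOn S ψ′ × AgreeOff v ψ′ ψ × ψ′ v ≡ d
  recolor {v = v} {ψ} d v∈S ψ-proper ψ′-proper with ψ v ≟ᶠ d
  ... | yes ψv≡d = ψ , ε , ψ-proper , (λ _ _ → refl) , ψv≡d
  ... | no ψv≢d  = ψ [ v ≔ d ] , step ◅ ε , ψ′-proper , (λ _ → ≔-minimal ψ v d) , ≔-updates ψ v d
    where
    step : Step _ ψ (ψ [ v ≔ d ])
    step = ψ-proper , ψ′-proper , v , v∈S , ≔-changes ψv≢d , agreeOff-≔ ψ v d

  record Recoloring (S : VSet H) (χ : Col) : Set where
    constructor recoloring
    field
      τ         : Col
      steps     : Star (Step S) χ τ
      proper    : ProperOn S τ
      unchanged : ∀ w → w ∉ S → τ w ≡ χ w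
      in-range  : ∀ w → w ∈ S → α ≤ toℕ (τ w) × toℕ (τ w) < α + β

  low-recoloring : ∀ {S χ} → S ⊆ R → Low χ → (ρ : Recoloring S χ) → Low (Recoloring.τ ρ)
  low-recoloring S⊆R χ-low ρ w w∉R =
    subst (λ c → toℕ c < α) (sym (Recoloring.unchanged ρ w (w∉R ∘ S⊆R))) (χ-low w w∉R)

  module Lift {S v} (S⊆R : S ⊆ R) (v∈S : v ∈ S) (low-degree : degreeIn H S v < β) where

    S-v⊆S : S - v ⊆ S
    S-v⊆S = p─q⊆p S ⁅ v ⁆

    record Lifted (ψ χ : Col) : Set where
      constructor lifted
      field
        ψ′     : Col
        steps  : Star (Step S) ψ ψ′
        agrees : AgreeOff v ψ′ χ
        proper : ProperOn S ψ′

    -- The new color c of v avoids the colors forced by χ₁ and the color u is about to take, so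
    -- neither recoloring v nor then moving u makes an edge through v monochromatic.
    lift-step : ∀ {χ₁ χ₂} → Step (S - v) χ₁ χ₂ → Low χ₁ → ∀ {ψ} → AgreeOff v ψ χ₁ → ProperOn S ψ → Lifted ψ χ₂
    lift-step {χ₁} {χ₂} st@(χ₁-proper , χ₂-proper , u , u∈S-v , χ₁u≢χ₂u , χ₁≈χ₂) χ₁-low {ψ} ψ≈χ₁ ψ-proper =
      via (fresh-color F |F|≤β)
      where
      F : List ℕ
      F = forcedColors χ₁ S v ++ [ toℕ (χ₂ u) ]
      |F|≤β : length F ≤ β
      |F|≤β = begin
        length F                                  ≡⟨ length-++ (forcedColors χ₁ S v) ⟩
        length (forcedColors χ₁ S v) + 1          ≡⟨ cong (_+ 1) (length-forcedColors χ₁ S v) ⟩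
        degreeIn H S v + 1                        ≡⟨ +-comm _ 1 ⟩
        suc (degreeIn H S v)                      ≤⟨ low-degree ⟩
        β                                         ∎
        where open ≤-Reasoning
      u≢v : u ≢ v
      u≢v refl = x∈p─q⇒x∉q u∈S-v (x∈⁅x⁆ u)
      χ₂≔-proper : ∀ c → α ≤ toℕ c → toℕ c ∉ˡ F → ProperOn S (χ₂ [ v ≔ c ])
      χ₂≔-proper c α≤c c∉F =
        properOn-≔ v∈S (λ _ _ → refl) χ₂-proper (low-step (λ x∈ → S⊆R (S-v⊆S x∈)) st χ₁-low) α≤c
          λ e e∈ e⊆S v∈e mono → c∉F (subst (_∈ˡ F) (cong toℕ (≔-updates χ₂ v c))
            (monochromatic⇒forced-or-moved (≔-agreeOff c (λ _ _ → refl)) χ₁≈χ₂ e∈ e⊆S v∈e mono))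
      via : (∃ λ (c : Fin q) → α ≤ toℕ c × toℕ c ≤ α + length F × toℕ c ∉ˡ F) → Lifted ψ χ₂
      via (c , α≤c , _ , c∉F)
        with recolor c v∈S ψ-proper (properOn-≔-fresh v∈S ψ≈χ₁ χ₁-proper χ₁-low α≤c (c∉F ∘ ∈-++⁺ˡ))
      ... | ψ₁ , ψ⇝ψ₁ , ψ₁-proper , ψ₁≈ψ , ψ₁v≡c =
        lifted (χ₂ [ v ≔ c ]) (ψ⇝ψ₁ ◅◅ (move-u ◅ ε)) (≔-agreeOff c (λ _ _ → refl)) (χ₂≔-proper c α≤c c∉F)
        where
        ψ₁≈χ₁ : AgreeOff v ψ₁ χ₁
        ψ₁≈χ₁ x x≢v = trans (ψ₁≈ψ x x≢v) (ψ≈χ₁ x x≢v)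
        ψ₁≈χ₂[v≔c] : AgreeOff u ψ₁ (χ₂ [ v ≔ c ])
        ψ₁≈χ₂[v≔c] x x≢u with x ≟ᶠ v
        ... | yes refl = trans ψ₁v≡c (sym (≔-updates χ₂ v c))
        ... | no x≢v   = trans (ψ₁≈χ₁ x x≢v) (trans (χ₁≈χ₂ x x≢u) (sym (≔-minimal χ₂ v c x≢v)))
        move-u : Step S ψ₁ (χ₂ [ v ≔ c ])
        move-u = ψ₁-proper , χ₂≔-proper c α≤c c∉F , u , S-v⊆S u∈S-v ,
          (λ eq → χ₁u≢χ₂u (trans (sym (ψ₁≈χ₁ u u≢v)) (trans eq (≔-minimal χ₂ v c u≢v)))) , ψ₁≈χ₂[v≔c]

    lift : ∀ {χ₁ χ₂} → Star (Step (S - v)) χ₁ χ₂ → Low χ₁ → ∀ {ψ} → AgreeOff v ψ χ₁ → ProperOn S ψ → Lifted ψ χ₂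
    lift ε          _     ψ≈χ ψ-proper = lifted _ ε ψ≈χ ψ-proper
    lift (st ◅ sts) χ-low ψ≈χ ψ-proper with lift-step st χ-low ψ≈χ ψ-proper
    ... | lifted ψ₁ P₁ ψ₁≈ p₁ with lift sts (low-step (λ x∈ → S⊆R (S-v⊆S x∈)) st χ-low) ψ₁≈ p₁
    ... | lifted ψ₂ P₂ ψ₂≈ p₂ = lifted ψ₂ (P₁ ◅◅ P₂) ψ₂≈ p₂

    extend : ∀ {χ} → Low χ → ProperOn S χ → Recoloring (S - v) χ → Recoloring S χ
    extend {χ} χ-low χ-proper ρ′@(recoloring τ′ χ⇝τ′ τ′-proper τ′-unchanged τ′-range) =
      finish (lift χ⇝τ′ χ-low (λ _ _ → refl) χ-proper) (fresh-color F (<⇒≤ |F|<β))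
      where
      F : List ℕ
      F = forcedColors τ′ S v
      |F|<β : length F < β
      |F|<β = subst (_< β) (sym (length-forcedColors τ′ S v)) low-degree
      τ′-low : Low τ′
      τ′-low = low-recoloring (λ x∈ → S⊆R (S-v⊆S x∈)) χ-low ρ′
      finish : Lifted χ τ′ → (∃ λ (d : Fin q) → α ≤ toℕ d × toℕ d ≤ α + length F × toℕ d ∉ˡ F) → Recoloring S χ
      finish (lifted ψ χ⇝ψ ψ≈τ′ ψ-proper) (d , α≤d , d≤α+|F| , d∉F)
        with recolor d v∈S ψ-proper (properOn-≔-fresh v∈S ψ≈τ′ τ′-proper τ′-low α≤d d∉F)
      ... | τ , ψ⇝τ , τ-proper , τ≈ψ , τv≡d = recoloring τ (χ⇝ψ ◅◅ ψ⇝τ) τ-proper unchanged in-range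
        where
        τ≈τ′ : AgreeOff v τ τ′
        τ≈τ′ x x≢v = trans (τ≈ψ x x≢v) (ψ≈τ′ x x≢v)
        unchanged : ∀ w → w ∉ S → τ w ≡ χ w
        unchanged w w∉S = trans (τ≈τ′ w λ { refl → w∉S v∈S }) (τ′-unchanged w (w∉S ∘ S-v⊆S))
        in-range : ∀ w → w ∈ S → α ≤ toℕ (τ w) × toℕ (τ w) < α + β
        in-range w w∈S with w ≟ᶠ v
        ... | yes refl = subst (λ c → α ≤ toℕ c × toℕ c < α + β) (sym τv≡d)
                               (α≤d , ≤-<-trans d≤α+|F| (+-monoʳ-< α |F|<β))
        ... | no w≢v   = subst (λ c → α ≤ toℕ c × toℕ c < α + β) (sym (τ≈τ′ w w≢v))
                               (τ′-range w (x∈p∧x≢y⇒x∈p-y w∈S w≢v))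

  recoloring-by-size : ∀ k S → ∣ S ∣ ≤ k → S ⊆ R → ¬ HasCore H β S → ∀ {χ} → Low χ → ProperOn S χ → Recoloring S χ
  recoloring-by-size k S |S|≤k S⊆R no-core {χ} χ-low χ-proper with nonempty? S
  ... | no empty = recoloring χ ε χ-proper (λ _ _ → refl) (λ w w∈S → ⊥-elim (empty (w , w∈S)))
  ... | yes nonempty with low-degree-vertex H S no-core nonempty | k
  ...   | v , v∈S , _      | zero   = ⊥-elim (n≮0 (<-≤-trans (x∈p⇒∣p-x∣<∣p∣ v∈S) |S|≤k))
  ...   | v , v∈S , deg<β  | suc k′ =
    Lift.extend S⊆R v∈S deg<β χ-low χ-proper
      (recoloring-by-size k′ (S - v) (≤-pred (≤-trans (x∈p⇒∣p-x∣<∣p∣ v∈S) |S|≤k))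
        (λ x∈ → S⊆R (S-v⊆S x∈)) (¬core-⊆ H S-v⊆S no-core) χ-low (properOn-⊆ S-v⊆S χ-proper))
    where
    S-v⊆S : S - v ⊆ S
    S-v⊆S = p─q⊆p S ⁅ v ⁆

  recoloring-coreless : ∀ {S} → S ⊆ R → ¬ HasCore H β S → ∀ {χ} → Low χ → ProperOn S χ → Recoloring S χ
  recoloring-coreless {S} = recoloring-by-size ∣ S ∣ S ≤-refl

  proper⇒properOn : ∀ {S χ} → Proper H χ → ProperOn S χ
  proper⇒properOn χ-proper e e∈ _ = χ-proper e e∈

  properOn-R⇒proper : ∀ {χ} → ProperOn R χ → Proper H χ
  properOn-R⇒proper χ-proper e e∈ = χ-proper e e∈ λ _ _ w∈R → w∈R

  steps⇒gammaPath : ∀ {χ τ} → Star (Step R) χ τ → GammaPath H q χ τ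
  steps⇒gammaPath = Star.map λ (χ-proper , τ-proper , u , _ , χu≢τu , χ≈τ) →
    properOn-R⇒proper χ-proper , properOn-R⇒proper τ-proper , u , χu≢τu , χ≈τ

  coloredAtLeast⇒low : ∀ {χ} → ColoredAtLeast α χ R → Low χ
  coloredAtLeast⇒low R≥α w w∉R = ≰⇒> (w∉R ∘ from (R≥α w))

  module _ {χ} (R≥α : ColoredAtLeast α χ R) (ρ : Recoloring R χ) where
    open Recoloring ρ

    recoloring-low : Low τ
    recoloring-low = low-recoloring id (coloredAtLeast⇒low R≥α) ρ

    recoloring-fixesBelow : FixesBelow α χ τ
    recoloring-fixesBelow x χx<α = unchanged x (<⇒≱ χx<α ∘ to (R≥α x))

    recoloring-bounded : ∀ w → suc (toℕ (τ w)) ≤ α + β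
    recoloring-bounded w with w ∈? R
    ... | yes w∈R = proj₂ (in-range w w∈R)
    ... | no w∉R  = <-≤-trans (recoloring-low w w∉R) (m≤m+n α β)

    recoloring-≥α⇒∈R : ∀ {w} → α ≤ toℕ (τ w) → w ∈ R
    recoloring-≥α⇒∈R {w} α≤τw with w ∈? R
    ... | yes w∈R = w∈R
    ... | no w∉R  = ⊥-elim (<⇒≱ (recoloring-low w w∉R) α≤τw)

lemma3 : (H : Hypergraph) (α β q : ℕ) → ColorableAB H α β →
    suc (α + β) ≤ q → (χ : Coloring H q) → Proper H χ →
    Σ (Coloring H q) λ τ → GoodGreedy H q α β τ × GammaPath H q χ τ
lemma3 H α β q colorable α+β<q χ χ-proper =
  τ , (τ-proper , recoloring-bounded R≥α ρ , (length-classesFrom τ 0 α , τ-sequence) , τ-coreless) ,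
  χ⇝χ′ ◅◅ steps⇒gammaPath steps
  where
  open Colorings H q
  open GreedySweeps H q
  open Greedy (greedy-sweeps χ χ-proper α (≤-trans (m≤m+n α β) (<⇒≤ α+β<q)))
    renaming (τ to χ′; path to χ⇝χ′; proper to χ′-proper; maximal to χ′-maximal)
  R : VSet H
  R = remove H ⊤ (classesFrom H χ′ 0 α)
  R≥α : ColoredAtLeast α χ′ R
  R≥α = coloredAtLeast-remove α (coloredAtLeast-⊤ χ′)
  R-coreless : ¬ HasCore H β R
  R-coreless = colorable _ (length-classesFrom χ′ 0 α ,
                            maxIndSeqFrom-classesFrom χ′-proper α (coloredAtLeast-⊤ χ′) λ i _ → χ′-maximal i)
  open DegenerateRecoloring H q α β α+β<q R (proper⇒nontrivialEdges H χ-proper)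
  ρ : Recoloring R χ′
  ρ = recoloring-coreless id R-coreless (coloredAtLeast⇒low R≥α) (proper⇒properOn χ′-proper)
  open Recoloring ρ
  τ-proper : Proper H τ
  τ-proper = properOn-R⇒proper proper
  τ-sequence : MaxIndSeqFrom H ⊤ (classesFrom H τ 0 α)
  τ-sequence = maxIndSeqFrom-classesFrom τ-proper α (coloredAtLeast-⊤ τ) λ i _ i<α →
    classMaximal-fixesBelow i<α (recoloring-fixesBelow R≥α ρ) (χ′-maximal i i<α)
  τ-coreless : ¬ HasCore H β (remove H ⊤ (classesFrom H τ 0 α))
  τ-coreless = ¬core-⊆ H (λ {x} x∈ → recoloring-≥α⇒∈R R≥α ρ (to (coloredAtLeast-remove α (coloredAtLeast-⊤ τ) x) x∈))
                       R-coreless
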